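{- For $k\ge 2$, no $k$-prn-irreducible comparability graph has a vertex adjacent to all other vertices.
   Context: All graphs are finite and simple. A comparability graph is a graph admitting a transitive orientation. A word over the vertex set represents a graph if distinct vertices are adjacent iff they alternate in the word (the subword formed by their occurrences is $abab\cdots$ or $baba\cdots$). Comparability graphs are exactly the graphs represented by a concatenation of permutations of their vertex set; $\mathcal{R}^p(C)$ is the least number of permutations whose concatenation represents $C$. For $k\ge 2$, a comparability graph $C=(V,E)$ is $k$-prn-irreducible if $\mathcal{R}^p(C)=k$ and $\mathcal{R}^p(C[V\setminus\{a\}])=k-1$ for every $a\in V$. -}

module Defs where

open import Data.Nat using (ℕ; zero; suc; _≤_; _∸_)
open import Data.Fin using (Fin; punchIn)
open import Data.Fin.Properties using (_≟_)
open import Data.List using (List; []; _∷_; filter; concat; length; allFin)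
open import Data.List.Relation.Binary.Permutation.Propositional using (_↭_)
open import Data.Product using (_×_; Σ; ∃; _,_)
open import Data.Sum using (_⊎_)
open import Data.Unit using (⊤)
open import Data.Empty using (⊥)
open import Relation.Nullary using (¬_)
open import Relation.Nullary.Decidable using (_⊎-dec_)
open import Relation.Binary.PropositionalEquality using (_≡_; _≢_)
open import Function.Bundles using (_⇔_)

record Graph (n : ℕ) : Set₁ where
  field
    Adj   : Fin n → Fin n → Set
    sym   : ∀ {a b} → Adj a b → Adj b a
    irrefl : ∀ {a} → ¬ Adj a a
open Graph public

IsTransitiveOrientation : ∀ {n} → Graph n → (Fin n → Fin n → Set) → Set
IsTransitiveOrientation G O =
  (∀ a b → a ≢ b → (Adj G a b ⇔ (O a b ⊎ O b a))) ×
  (∀ a b → O a b → Adj G a b) ×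
  (∀ a b → O a b → ¬ O b a) ×
  (∀ a b c → O a b → O b c → O a c)

IsComparability : ∀ {n} → Graph n → Set₁
IsComparability {n} G = Σ (Fin n → Fin n → Set) λ O → IsTransitiveOrientation G O

restrict : ∀ {n} → Fin n → Fin n → List (Fin n) → List (Fin n)
restrict a b = filter (λ x → (x ≟ a) ⊎-dec (x ≟ b))

-- A word alternates if no two consecutive letters are equal
-- (for a word over {a,b} this means it is abab⋯ or baba⋯).
Alternating : ∀ {n} → List (Fin n) → Set
Alternating [] = ⊤
Alternating (x ∷ []) = ⊤
Alternating (x ∷ y ∷ r) = x ≢ y × Alternating (y ∷ r)

Represents : ∀ {n} → Graph n → List (Fin n) → Set
Represents G w = ∀ a b → a ≢ b → (Adj G a b ⇔ Alternating (restrict a b w))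

RepByPerms : ∀ {n} → Graph n → ℕ → Set
RepByPerms {n} G k =
  1 ≤ k × Σ (List (List (Fin n))) λ ps →
    length ps ≡ k × (∀ {p} → p ∈ ps → p ↭ allFin n) × Represents G (concat ps)
  where open import Data.List.Membership.Propositional using (_∈_)

Rp≡ : ∀ {n} → Graph n → ℕ → Set
Rp≡ G k = RepByPerms G k × (∀ j → RepByPerms G j → k ≤ j)

delete : ∀ {n} → Graph (suc n) → Fin (suc n) → Graph n
delete G a = record
  { Adj = λ i j → Adj G (punchIn a i) (punchIn a j)
  ; sym = sym G
  ; irrefl = irrefl G
  }

PrnIrreducible : ∀ {n} → ℕ → Graph (suc n) → Set₁
PrnIrreducible k G =
  IsComparability G × Rp≡ G k × (∀ a → Rp≡ (delete G a) (k ∸ 1))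

HasDominatingVertex : ∀ {n} → Graph n → Set
HasDominatingVertex {n} G = ∃ λ (v : Fin n) → ∀ u → u ≢ v → Adj G v u

{-# OPTIONS --safe #-}
-- If v is adjacent to every other vertex and p₁ ⋯ pₘ represents G − v by
-- permutations, then (v p₁)(v p₂) ⋯ (v pₘ) represents G: between two occurrences
-- of v every other vertex occurs exactly once, so v alternates with everything,
-- while on pairs avoiding v the subwords are those of p₁ ⋯ pₘ, relabelled.
-- Hence 𝓡ᵖ(G) ≤ 𝓡ᵖ(G − v), which is impossible when 𝓡ᵖ(G − v) = 𝓡ᵖ(G) − 1.
module Submission where

open import Defs hiding (sym)
open import Data.Nat using (ℕ; suc; _≤_; s≤s)
open import Data.Nat.Properties using (n≮n)
open import Data.Fin using (Fin; zero; suc; punchIn)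
open import Data.Fin.Properties using (_≟_; punchIn-injective; punchInᵢ≢i; punchIn-punchOut)
open import Data.List using (List; []; _∷_; _++_; map; concat; filter; tabulate; allFin; replicate; length)
open import Data.List.Properties using (filter-accept; filter-reject; filter-none; filter-++; filter-≐; map-++; map-tabulate; length-map)
open import Data.List.Relation.Binary.Permutation.Propositional using (_↭_; ↭-refl; ↭-trans; prep; swap)
open import Data.List.Relation.Binary.Permutation.Propositional.Properties using (map⁺; filter-↭; ↭-singleton-inv)
open import Data.List.Membership.Propositional using (_∈_)
open import Data.List.Membership.Propositional.Properties using (∈-allFin; ∈-map⁻)
open import Data.List.Relation.Unary.Any using (here; there)
import Data.List.Relation.Unary.All as All
open import Data.List.Relation.Unary.AllPairs using (_∷_)
open import Data.List.Relation.Unary.Unique.Propositional using (Unique)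
open import Data.List.Relation.Unary.Unique.Propositional.Properties using (allFin⁺)
open import Data.Product using (_,_; proj₁)
open import Data.Sum using (_⊎_; inj₁; inj₂)
import Data.Sum as Sum
open import Data.Bool using (true; false)
open import Data.Unit using (tt)
open import Data.Empty using (⊥-elim)
open import Function using (_∘_; id)
open import Function.Bundles using (_⇔_; mk⇔)
open import Function.Definitions using (Injective)
import Function.Properties.Equivalence as ⇔
open import Relation.Nullary using (¬_; does; yes; no)
open import Relation.Nullary.Decidable using (_⊎-dec_)
open import Relation.Unary using (Pred; Decidable)
open import Relation.Binary.Definitions using (DecidableEquality)
open import Relation.Binary.PropositionalEquality using (_≡_; _≢_; refl; sym; trans; cong; cong₂; subst; module ≡-Reasoning)

filter-map : ∀ {A B : Set} {ℓ} {P : Pred B ℓ} (P? : Decidable P) (f : A → B) xs →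
             filter P? (map f xs) ≡ map f (filter (P? ∘ f) xs)
filter-map P? f []       = refl
filter-map P? f (x ∷ xs) with does (P? (f x))
... | true  = cong (f x ∷_) (filter-map P? f xs)
... | false = filter-map P? f xs

module _ {A : Set} (_≟_ : DecidableEquality A) where

  filter-≟-Unique : ∀ {xs y} → Unique xs → y ∈ xs → filter (_≟ y) xs ≡ y ∷ []
  filter-≟-Unique {y = y} (y∉xs ∷ _) (here refl) =
    trans (filter-accept (_≟ y) refl)
          (cong (y ∷_) (filter-none (_≟ y) (All.map (λ y≢z → y≢z ∘ sym) y∉xs)))
  filter-≟-Unique {y = y} (x∉xs ∷ xs-unique) (there y∈xs) =
    trans (filter-reject (_≟ y) (All.lookup x∉xs y∈xs))
          (filter-≟-Unique xs-unique y∈xs)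

filter-≟-↭-allFin : ∀ {n} {p : List (Fin n)} (y : Fin n) → p ↭ allFin n → filter (_≟ y) p ≡ y ∷ []
filter-≟-↭-allFin {n} {p} y p↭ =
  ↭-singleton-inv (subst (filter (_≟ y) p ↭_)
                         (filter-≟-Unique _≟_ (allFin⁺ n) (∈-allFin y))
                         (filter-↭ (_≟ y) p↭))

tabulate-punchIn-↭ : ∀ {A : Set} {n} (i : Fin (suc n)) (f : Fin (suc n) → A) →
                     f i ∷ tabulate (f ∘ punchIn i) ↭ tabulate f
tabulate-punchIn-↭ zero    f = ↭-refl
tabulate-punchIn-↭ {n = suc _} (suc i) f =
  ↭-trans (swap (f (suc i)) (f zero) ↭-refl) (prep (f zero) (tabulate-punchIn-↭ i (f ∘ suc)))

module _ {m n} {f : Fin m → Fin n} where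

  Alternating-map⁺ : Injective _≡_ _≡_ f → ∀ l → Alternating l → Alternating (map f l)
  Alternating-map⁺ f-inj []          _          = tt
  Alternating-map⁺ f-inj (x ∷ [])    _          = tt
  Alternating-map⁺ f-inj (x ∷ y ∷ l) (x≢y , alt) = x≢y ∘ f-inj , Alternating-map⁺ f-inj (y ∷ l) alt

  Alternating-map⁻ : ∀ l → Alternating (map f l) → Alternating l
  Alternating-map⁻ []          _            = tt
  Alternating-map⁻ (x ∷ [])    _            = tt
  Alternating-map⁻ (x ∷ y ∷ l) (fx≢fy , alt) = fx≢fy ∘ cong f , Alternating-map⁻ (y ∷ l) alt

  Alternating-map : Injective _≡_ _≡_ f → ∀ l → Alternating (map f l) ⇔ Alternating l
  Alternating-map f-inj l = mk⇔ (Alternating-map⁻ l) (Alternating-map⁺ f-inj l)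

Alternating-replicate : ∀ {n} {a b : Fin n} → a ≢ b → ∀ m → Alternating (concat (replicate m (a ∷ b ∷ [])))
Alternating-replicate a≢b 0             = tt
Alternating-replicate a≢b 1             = a≢b , tt
Alternating-replicate a≢b (suc (suc m)) = a≢b , a≢b ∘ sym , Alternating-replicate a≢b (suc m)

restrict-sym : ∀ {n} (a b : Fin n) → ∀ l → restrict a b l ≡ restrict b a l
restrict-sym a b = filter-≐ _ _ (Sum.swap , Sum.swap)

restrict-++ : ∀ {n} (a b : Fin n) → ∀ xs ys → restrict a b (xs ++ ys) ≡ restrict a b xs ++ restrict a b ys
restrict-++ a b = filter-++ _

restrict-accept : ∀ {n} {a b x : Fin n} {xs} → x ≡ a ⊎ x ≡ b → restrict a b (x ∷ xs) ≡ x ∷ restrict a b xs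
restrict-accept {a = a} {b} = filter-accept (λ z → (z ≟ a) ⊎-dec (z ≟ b))

restrict-reject : ∀ {n} {a b x : Fin n} {xs} → ¬ (x ≡ a ⊎ x ≡ b) → restrict a b (x ∷ xs) ≡ restrict a b xs
restrict-reject {a = a} {b} = filter-reject (λ z → (z ≟ a) ⊎-dec (z ≟ b))

module _ {n} (v : Fin (suc n)) where

  private
    ι : Fin n → Fin (suc n)
    ι = punchIn v

    ι-injective : Injective _≡_ _≡_ ι
    ι-injective = punchIn-injective v _ _

  cone : List (Fin n) → List (Fin (suc n))
  cone p = v ∷ map ι p

  cone-↭ : ∀ {p} → p ↭ allFin n → cone p ↭ allFin (suc n)
  cone-↭ {p} p↭ =
    ↭-trans (prep v (subst (map ι p ↭_) (map-tabulate id ι) (map⁺ ι p↭)))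
            (tabulate-punchIn-↭ v id)

  restrict-map-punchIn : ∀ x y l → restrict (ι x) (ι y) (map ι l) ≡ map ι (restrict x y l)
  restrict-map-punchIn x y l =
    trans (filter-map _ ι l)
          (cong (map ι) (filter-≐ _ _ (Sum.map ι-injective ι-injective , Sum.map (cong ι) (cong ι)) l))

  restrict-apex-map-punchIn : ∀ y l → restrict v (ι y) (map ι l) ≡ map ι (filter (_≟ y) l)
  restrict-apex-map-punchIn y l =
    trans (filter-map _ ι l)
          (cong (map ι) (filter-≐ _ _ (Sum.[ ⊥-elim ∘ punchInᵢ≢i v _ , ι-injective ] , inj₂ ∘ cong ι) l))

  restrict-cone : ∀ x y p → restrict (ι x) (ι y) (cone p) ≡ map ι (restrict x y p)
  restrict-cone x y p =
    trans (restrict-reject Sum.[ punchInᵢ≢i v x ∘ sym , punchInᵢ≢i v y ∘ sym ])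
          (restrict-map-punchIn x y p)

  restrict-apex-cone : ∀ y {p} → p ↭ allFin n → restrict v (ι y) (cone p) ≡ v ∷ ι y ∷ []
  restrict-apex-cone y {p} p↭ =
    trans (restrict-accept (inj₁ refl))
          (cong (v ∷_) (trans (restrict-apex-map-punchIn y p) (cong (map ι) (filter-≟-↭-allFin y p↭))))

  restrict-concat-cone : ∀ x y ps → restrict (ι x) (ι y) (concat (map cone ps)) ≡ map ι (restrict x y (concat ps))
  restrict-concat-cone x y []       = refl
  restrict-concat-cone x y (p ∷ ps) = begin
    restrict (ι x) (ι y) (cone p ++ concat (map cone ps))
      ≡⟨ restrict-++ (ι x) (ι y) (cone p) _ ⟩
    restrict (ι x) (ι y) (cone p) ++ restrict (ι x) (ι y) (concat (map cone ps))
      ≡⟨ cong₂ _++_ (restrict-cone x y p) (restrict-concat-cone x y ps) ⟩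
    map ι (restrict x y p) ++ map ι (restrict x y (concat ps))
      ≡⟨ map-++ ι (restrict x y p) _ ⟨
    map ι (restrict x y p ++ restrict x y (concat ps))
      ≡⟨ cong (map ι) (restrict-++ x y p (concat ps)) ⟨
    map ι (restrict x y (p ++ concat ps)) ∎
    where open ≡-Reasoning

  restrict-apex-concat-cone : ∀ y ps → (∀ {p} → p ∈ ps → p ↭ allFin n) →
    restrict v (ι y) (concat (map cone ps)) ≡ concat (replicate (length ps) (v ∷ ι y ∷ []))
  restrict-apex-concat-cone y []       _     = refl
  restrict-apex-concat-cone y (p ∷ ps) perms =
    trans (restrict-++ v (ι y) (cone p) _)
          (cong₂ _++_ (restrict-apex-cone y (perms (here refl)))
                      (restrict-apex-concat-cone y ps (perms ∘ there)))

  data PunchInView : Fin (suc n) → Set where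
    apex    : PunchInView v
    punched : ∀ x → PunchInView (ι x)

  punchInView : ∀ a → PunchInView a
  punchInView a with a ≟ v
  ... | yes refl = apex
  ... | no  a≢v  = subst PunchInView (punchIn-punchOut (a≢v ∘ sym)) (punched _)

  Alternating-restrict-apex : ∀ y ps → (∀ {p} → p ∈ ps → p ↭ allFin n) →
                              Alternating (restrict v (ι y) (concat (map cone ps)))
  Alternating-restrict-apex y ps perms =
    subst Alternating (sym (restrict-apex-concat-cone y ps perms))
          (Alternating-replicate (punchInᵢ≢i v y ∘ sym) (length ps))

  represents-cone : (G : Graph (suc n)) → (∀ u → u ≢ v → Adj G v u) →
                    ∀ {ps} → (∀ {p} → p ∈ ps → p ↭ allFin n) →
                    Represents (delete G v) (concat ps) → Represents G (concat (map cone ps))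
  represents-cone G v-dominating {ps} perms rep a b a≢b with punchInView a | punchInView b
  ... | apex      | apex      = ⊥-elim (a≢b refl)
  ... | apex      | punched y =
    mk⇔ (λ _ → Alternating-restrict-apex y ps perms)
        (λ _ → v-dominating (ι y) (punchInᵢ≢i v y))
  ... | punched x | apex      =
    mk⇔ (λ _ → subst Alternating (restrict-sym v (ι x) (concat (map cone ps)))
                              (Alternating-restrict-apex x ps perms))
        (λ _ → Graph.sym G (v-dominating (ι x) (punchInᵢ≢i v x)))
  ... | punched x | punched y =
    subst (λ w → Adj G (ι x) (ι y) ⇔ Alternating w) (sym (restrict-concat-cone x y ps))
          (⇔.trans (rep x y (a≢b ∘ cong ι)) (⇔.sym (Alternating-map ι-injective _)))

  RepByPerms-cone : ∀ {j} (G : Graph (suc n)) → (∀ u → u ≢ v → Adj G v u) →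
                    RepByPerms (delete G v) j → RepByPerms G j
  RepByPerms-cone G v-dominating (1≤j , ps , |ps|≡j , perms , rep) =
    1≤j , map cone ps , trans (length-map cone ps) |ps|≡j , cone-perms ,
    represents-cone G v-dominating perms rep
    where
    cone-perms : ∀ {q} → q ∈ map cone ps → q ↭ allFin (suc n)
    cone-perms q∈ with ∈-map⁻ cone q∈
    ... | p , p∈ps , refl = cone-↭ (perms p∈ps)

proposition3 : (k : ℕ) → 2 ≤ k → (n : ℕ) → (G : Graph (suc n)) →
               PrnIrreducible k G → ¬ HasDominatingVertex G
proposition3 (suc k) (s≤s _) n G (_ , (_ , minimal) , irreducible) (v , v-dominating) =
  n≮n k (minimal k (RepByPerms-cone v G v-dominating (proj₁ (irreducible v))))
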